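{- Let $A$ be an alphabet of constant size and $T=T[1..n]$ a string over $A$. Run the following algorithm on $T$. Create nodes $root$ and $\perp$; set $f(root)\gets\perp$; for every $a\in A$ set an $a$-edge from $\perp$ to $root$. Set $currentnode\gets root$, $currentsuffix\gets 1$. For $i=1$ to $n$: set $lastcreatednode\gets undefined$; while $currentnode$ has no outgoing $T[i]$-edge: create a new node $newnode$ storing position $currentsuffix$, set a $T[i]$-edge from $currentnode$ to $newnode$, if $lastcreatednode\ne undefined$ set $f(lastcreatednode)\gets newnode$, set $lastcreatednode\gets newnode$, $currentnode\gets f(currentnode)$, $currentsuffix\gets currentsuffix+1$. After the while loop, move $currentnode$ to the target of its outgoing $T[i]$-edge, and if $lastcreatednode\ne undefined$ set $f(lastcreatednode)\gets currentnode$. Then the algorithm constructs $\mathrm{PH}(T)$ on-line: for every $k\in\{1,\ldots,n\}$, after the $k$-th iteration of the for-loop, the trie rooted at $root$ (ignoring $\perp$), with each node storing the position assigned at its creation, is the position heap $\mathrm{PH}(T[1..k])$ with each node storing its primary position (secondary positions are not stored explicitly), and $f$ restricted to the non-root nodes is the suffix pointer function of $\mathrm{PH}(T[1..k])$. Moreover, the total running time of the algorithm is $O(n)$.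
   Context: Strings are indexed from 1; $T[i..j]=T[i]\cdots T[j]$. A trie is a rooted tree with edges directed away from the root labeled by letters, distinct letters on edges leaving the same node; a node's path label is the string read from the root to it; a string $w$ is represented if it is some node's path label, and that node is denoted $\overline{w}$. The position heap $\mathrm{PH}(S)$ of a string $S[1..m]$: start with a single root node; for $i=1,\ldots,m$ in this order insert suffix $S[i..m]$: if $S[i..m]$ is already represented, add position $i$ to node $\overline{S[i..m]}$; otherwise let $v'$ be the longest represented prefix of $S[i..m]$ and $a$ the letter following it, and create a new child of $\overline{v'}$ via an $a$-edge storing position $i$. Each node stores one or two positions; if it stores $i<j$, $i$ is its primary and $j$ its secondary position (a single stored position is primary). Suffix pointers: for each non-root node $\overline{S[i..j]}$ of $\mathrm{PH}(S)$, $f(\overline{S[i..j]})=\overline{S[i+1..j]}$ (this node always exists); by convention $f(root)=\perp$, an auxiliary node with an $a$-edge to the root for every letter $a$. Running time is measured with constant-time operations on nodes, edges and integers. -}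

module Defs where

open import Data.Nat using (ℕ; zero; suc; _+_; _*_; _∸_; _⊓_; _<_; _≤_)
import Data.Nat as ℕ
open import Data.Fin using (Fin; fromℕ<)
import Data.Fin as Fin
open import Data.List using (List; []; _∷_; _++_; [_]; length; take; drop; lookup; map; foldr)
open import Data.List.Properties using (≡-dec)
open import Data.List.Membership.Propositional using (_∈_)
open import Data.List.Membership.DecPropositional using () renaming (_∈?_ to ∈?-gen)
open import Data.Maybe using (Maybe; just; nothing)
open import Data.Product using (Σ; _×_; _,_; proj₁; proj₂)
open import Data.Sum using (_⊎_)
open import Data.Bool using (Bool; true; false; if_then_else_; _∧_)
open import Relation.Nullary using (Dec; yes; no; ¬_)
open import Relation.Nullary.Decidable using (⌊_⌋)
open import Relation.Binary.PropositionalEquality using (_≡_; _≢_)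

-- A heap is a list of its non-root nodes: (path label, stored positions).
-- The root (path label []) is always present and stores no position.
Heap : ℕ → Set
Heap σ = List (List (Fin σ) × List ℕ)

labelDec : ∀ {σ} (u v : List (Fin σ)) → Dec (u ≡ v)
labelDec = ≡-dec Fin._≟_

Represented : ∀ {σ} → Heap σ → List (Fin σ) → Set
Represented H w = w ≡ [] ⊎ w ∈ map proj₁ H

represented? : ∀ {σ} (H : Heap σ) (w : List (Fin σ)) → Bool
represented? H [] = true
represented? H (x ∷ w) = ⌊ ∈?-gen labelDec (x ∷ w) (map proj₁ H) ⌋

lrp : ∀ {σ} → Heap σ → List (Fin σ) → ℕ → ℕ
lrp H u zero = 0
lrp H u (suc k) = if represented? H (take (suc k) u) then suc k else lrp H u k

addPos : ∀ {σ} → List (Fin σ) → ℕ → Heap σ → Heap σ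
addPos u i [] = []
addPos u i ((w , ps) ∷ H) with labelDec u w
... | yes _ = (w , ps ++ [ i ]) ∷ H
... | no _ = (w , ps) ∷ addPos u i H

insertSuffix : ∀ {σ} → List (Fin σ) → ℕ → Heap σ → Heap σ
insertSuffix u i H with represented? H u
... | true = addPos u i H
... | false = H ++ [ (take (suc (lrp H u (length u))) u , i ∷ []) ]

-- insert S[i..m], S[i+1..m], ..., S[m..m]  (the argument is S[i..m])
insertFrom : ∀ {σ} → ℕ → List (Fin σ) → Heap σ → Heap σ
insertFrom i [] H = H
insertFrom i (x ∷ xs) H = insertFrom (suc i) xs (insertSuffix (x ∷ xs) i H)

PH : ∀ {σ} → List (Fin σ) → Heap σ
PH S = insertFrom 1 S []

-- positions stored at node with label w (empty if no such non-root node)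
positionsOf : ∀ {σ} → Heap σ → List (Fin σ) → List ℕ
positionsOf [] w = []
positionsOf ((v , ps) ∷ H) w with labelDec w v
... | yes _ = ps
... | no _ = positionsOf H w

primary : List ℕ → Maybe ℕ
primary [] = nothing
primary (x ∷ xs) = just (foldr _⊓_ x xs)

bot root : ℕ
bot = 0
root = 1

record State (σ : ℕ) : Set where
  field
    edges  : ℕ → Fin σ → Maybe ℕ
    suf    : ℕ → Maybe ℕ
    pos    : ℕ → Maybe ℕ            -- position stored at creation
    next   : ℕ                      -- next fresh node identifier
    cur    : ℕ
    csuf   : ℕ
open State public

initState : ∀ {σ} → State σ
initState = record
  { edges = λ u a → if ⌊ u ℕ.≟ bot ⌋ then just root else nothing
  ; suf = λ u → if ⌊ u ℕ.≟ root ⌋ then just bot else nothing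
  ; pos = λ _ → nothing
  ; next = 2
  ; cur = root
  ; csuf = 1
  }

updEdge : ∀ {σ} → (ℕ → Fin σ → Maybe ℕ) → ℕ → Fin σ → ℕ → (ℕ → Fin σ → Maybe ℕ)
updEdge e u a v x b = if ⌊ x ℕ.≟ u ⌋ ∧ ⌊ b Fin.≟ a ⌋ then just v else e x b

updFun : (ℕ → Maybe ℕ) → ℕ → ℕ → (ℕ → Maybe ℕ)
updFun g u v x = if ⌊ x ℕ.≟ u ⌋ then just v else g x

setLast : (ℕ → Maybe ℕ) → Maybe ℕ → ℕ → (ℕ → Maybe ℕ)
setLast g nothing v = g
setLast g (just l) v = updFun g l v

-- While a s l s' l' t : starting in state s with lastcreatednode = l, the loop
--   terminates in state s' with lastcreatednode = l' after t steps
--   (each test of the loop condition and each execution of the loop body,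
--    both consisting of O(1) elementary operations, counts as one step).
data While {σ} (a : Fin σ) : State σ → Maybe ℕ → State σ → Maybe ℕ → ℕ → Set where
  stop : ∀ {s l v} → edges s (cur s) a ≡ just v → While a s l s l 1
  loop : ∀ {s l s'' l'' t c'} →
         edges s (cur s) a ≡ nothing →
         setLast (suf s) l (next s) (cur s) ≡ just c' →
         While a (record s
                    { edges = updEdge (edges s) (cur s) a (next s)
                    ; suf = setLast (suf s) l (next s)
                    ; pos = updFun (pos s) (next s) (csuf s)
                    ; next = suc (next s)
                    ; cur = c'
                    ; csuf = suc (csuf s)
                    }) (just (next s)) s'' l'' t →
         While a s l s'' l'' (suc (suc t))

data Iter {σ} (a : Fin σ) : State σ → State σ → ℕ → Set where
  iter : ∀ {s s' l' t v} →
         While a s nothing s' l' t →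
         edges s' (cur s') a ≡ just v →
         Iter a s (record s' { cur = v ; suf = setLast (suf s') l' v }) (suc (suc t))

-- After T k s t : after the k-th iteration of the for-loop on input T the
-- state is s, and t steps have been spent in total (including initialisation,
-- which costs σ + 1 steps: σ edges from ⊥ plus O(1) further operations).
data After {σ} (T : List (Fin σ)) : ℕ → State σ → ℕ → Set where
  start : After T 0 initState (suc σ)
  step  : ∀ {k s t s' t'} → After T k s t → (k<n : k < length T) →
          Iter (lookup T (fromℕ< k<n)) s s' t' →
          After T (suc k) s' (t + t')

data Reach {σ} (s : State σ) : ℕ → List (Fin σ) → ℕ → Set where
  here  : ∀ {u} → Reach s u [] u
  there : ∀ {u a v w x} → edges s u a ≡ just v → Reach s v w x → Reach s u (a ∷ w) x

Label : ∀ {σ} → State σ → List (Fin σ) → ℕ → Set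
Label s w u = Reach s root w u

Correct : ∀ {σ} → List (Fin σ) → State σ → Set
Correct {σ} S s =
    (∀ w → Σ ℕ (Label s w) → Represented (PH S) w)
  × (∀ w → Represented (PH S) w → Σ ℕ (Label s w))
  × (∀ w w' u → Label s w u → Label s w' u → w ≡ w')
  × (∀ w u → w ≢ [] → Label s w u → pos s u ≡ primary (positionsOf (PH S) w))
  × (∀ a w u → Label s (a ∷ w) u → Σ ℕ λ v → suf s u ≡ just v × Label s w v)

-- Let w₁, …, w_p be the labels of the nodes created so far, in order of creation. The invariant
-- is that in the construction of PH(S) the i-th suffix, for i ≤ p, creates exactly the node wᵢ,
-- storing position i, while every later suffix S[p+1..], S[p+2..], … is already represented and
-- only adds secondary positions; currentnode is the node of S[p+1..], or ⊥ when p = |S| + 1.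
-- Reading a, either S[p+1..]a is represented and currentnode follows its a-edge, or the node
-- S[p+1..]a is created (it is the node the (p+1)-st suffix of Sa creates) and currentnode moves
-- along its suffix pointer to S[p+2..]. The node created last receives as suffix pointer the next
-- node created or reached, which is labelled by its own label without the first letter.
-- Each failed loop test creates a node and p ≤ |S|, so the cost 3|S| + 2p + σ + 1 is linear.

module Submission where

open import Defs
open import Data.Nat using (ℕ; zero; suc; _+_; _*_; _∸_; _⊓_; _<_; _≤_; z≤n; s≤s)
import Data.Nat as ℕ
open import Data.Nat.Properties
open import Data.Fin using (Fin; fromℕ<)
import Data.Fin as Fin
open import Data.Fin.Properties using (toℕ-fromℕ<)
open import Data.List using (List; []; _∷_; _++_; [_]; _∷ʳ_; length; take; drop; lookup; map; foldr)
open import Data.List.Properties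
  using (++-assoc; ++-identityʳ; ∷ʳ-injective; length-++; length-++-≤ˡ; take-suc; take-all; drop-all; length-drop)
open import Data.List.Membership.Propositional using (_∈_)
open import Data.List.Membership.Propositional.Properties using (∈-++⁻; ∈-++⁺ˡ)
open import Data.List.Membership.DecPropositional using () renaming (_∈?_ to ∈?-with)
open import Data.List.Relation.Unary.Any using (here; there)
open import Data.List.Relation.Unary.All using (All; []; _∷_)
open import Data.List.Relation.Unary.All.Properties using (∷ʳ⁺)
open import Data.Maybe using (Maybe; just; nothing)
open import Data.Maybe.Properties using (just-injective)
open import Data.Product using (Σ; ∃; _×_; _,_; proj₁; proj₂)
open import Data.Sum using (_⊎_; inj₁; inj₂)
open import Data.Bool using (true; false; if_then_else_)
open import Relation.Nullary using (Dec; ¬_; contradiction)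
open import Relation.Nullary.Decidable using (⌊_⌋; yes; no; isYes≗does; dec-true; dec-false)
open import Function using (_∘_; flip)
open import Relation.Binary.PropositionalEquality hiding ([_])

isYes-true : ∀ {A : Set} (a? : Dec A) → A → ⌊ a? ⌋ ≡ true
isYes-true a? a = trans (isYes≗does a?) (dec-true a? a)

isYes-false : ∀ {A : Set} (a? : Dec A) → ¬ A → ⌊ a? ⌋ ≡ false
isYes-false a? ¬a = trans (isYes≗does a?) (dec-false a? ¬a)

module _ {A : Set} where

  infix 4 _[_]=_

  data _[_]=_ : List A → ℕ → A → Set where
    at-zero : ∀ {x xs} → (x ∷ xs) [ 0 ]= x
    at-suc  : ∀ {x y xs i} → xs [ i ]= y → (x ∷ xs) [ suc i ]= y

  []=-functional : ∀ {xs i x y} → xs [ i ]= x → xs [ i ]= y → x ≡ y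
  []=-functional at-zero    at-zero    = refl
  []=-functional (at-suc p) (at-suc q) = []=-functional p q

  []=⇒<length : ∀ {xs i x} → xs [ i ]= x → i < length xs
  []=⇒<length at-zero    = s≤s z≤n
  []=⇒<length (at-suc p) = s≤s ([]=⇒<length p)

  []=⇒∈ : ∀ {xs i x} → xs [ i ]= x → x ∈ xs
  []=⇒∈ at-zero    = here refl
  []=⇒∈ (at-suc p) = there ([]=⇒∈ p)

  ∈⇒[]= : ∀ {xs x} → x ∈ xs → ∃ λ i → xs [ i ]= x
  ∈⇒[]= (here refl) = 0 , at-zero
  ∈⇒[]= (there m) with ∈⇒[]= m
  ... | i , p = suc i , at-suc p

  []=-++⁺ : ∀ {xs i x} ys → xs [ i ]= x → (xs ++ ys) [ i ]= x
  []=-++⁺ ys at-zero    = at-zero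
  []=-++⁺ ys (at-suc p) = at-suc ([]=-++⁺ ys p)

  []=-∷ʳ : ∀ xs y → (xs ∷ʳ y) [ length xs ]= y
  []=-∷ʳ []       y = at-zero
  []=-∷ʳ (x ∷ xs) y = at-suc ([]=-∷ʳ xs y)

  []=-∷ʳ⁻ : ∀ xs {y i x} → (xs ∷ʳ y) [ i ]= x → xs [ i ]= x ⊎ (i ≡ length xs × x ≡ y)
  []=-∷ʳ⁻ []       at-zero          = inj₂ (refl , refl)
  []=-∷ʳ⁻ (z ∷ xs) at-zero          = inj₁ at-zero
  []=-∷ʳ⁻ (z ∷ xs) (at-suc p) with []=-∷ʳ⁻ xs p
  ... | inj₁ q              = inj₁ (at-suc q)
  ... | inj₂ (refl , refl)  = inj₂ (refl , refl)

  Distinct : List A → Set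
  Distinct xs = ∀ {i j x} → xs [ i ]= x → xs [ j ]= x → i ≡ j

  length-∷ʳ : ∀ (xs : List A) y → length (xs ∷ʳ y) ≡ suc (length xs)
  length-∷ʳ xs y = trans (length-++ xs) (+-comm (length xs) 1)

  ∷ʳ≢[] : ∀ (xs : List A) y → xs ∷ʳ y ≢ []
  ∷ʳ≢[] xs y e = 1+n≢0 (trans (sym (length-∷ʳ xs y)) (cong length e))

  ≢∷∷ʳ : ∀ (xs : List A) x y → xs ≢ x ∷ (xs ∷ʳ y)
  ≢∷∷ʳ xs x y e = m≢1+m+n (length xs) (trans (cong length e) (cong suc (trans (length-∷ʳ xs y) (+-comm 1 (length xs)))))

  take-length-++ : ∀ (xs ys : List A) n → take (length xs + n) (xs ++ ys) ≡ xs ++ take n ys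
  take-length-++ []       ys n = refl
  take-length-++ (x ∷ xs) ys n = cong (x ∷_) (take-length-++ xs ys n)

  drop-++ : ∀ n (xs ys : List A) → n ≤ length xs → drop n (xs ++ ys) ≡ drop n xs ++ ys
  drop-++ zero    xs       ys _         = refl
  drop-++ (suc n) (x ∷ xs) ys (s≤s n≤) = drop-++ n xs ys n≤

  drop-suc : ∀ n (xs : List A) → n < length xs → ∃ λ y → drop n xs ≡ y ∷ drop (suc n) xs
  drop-suc zero    (x ∷ xs) _         = x , refl
  drop-suc (suc n) (x ∷ xs) (s≤s n<) = drop-suc n xs n<

  drop-≡∷ : ∀ n (xs : List A) {y ys} → drop n xs ≡ y ∷ ys → n < length xs × ys ≡ drop (suc n) xs
  drop-≡∷ zero    (x ∷ xs) refl = s≤s z≤n , refl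
  drop-≡∷ (suc n) (x ∷ xs) e    = let n< , ys≡ = drop-≡∷ n xs e in s≤s n< , ys≡

  drop-≡[] : ∀ n (xs : List A) → drop n xs ≡ [] → length xs ≤ n
  drop-≡[] n xs e = m∸n≡0⇒m≤n (trans (sym (length-drop n xs)) (cong length e))

  Distinct-∷⁻ : ∀ {x xs} → Distinct (x ∷ xs) → Distinct xs
  Distinct-∷⁻ d p q = suc-injective (d (at-suc p) (at-suc q))

  Distinct-∷ʳ : ∀ {xs x} → Distinct xs → ¬ x ∈ xs → Distinct (xs ∷ʳ x)
  Distinct-∷ʳ {xs} d x∉ p q with []=-∷ʳ⁻ xs p | []=-∷ʳ⁻ xs q
  ... | inj₁ p′             | inj₁ q′             = d p′ q′
  ... | inj₁ p′             | inj₂ (_ , refl)     = contradiction ([]=⇒∈ p′) x∉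
  ... | inj₂ (_ , refl)     | inj₁ q′             = contradiction ([]=⇒∈ q′) x∉
  ... | inj₂ (refl , _)     | inj₂ (refl , _)     = refl

  take-suc-lookup : ∀ (xs : List A) k (k< : k < length xs) → take (suc k) xs ≡ take k xs ∷ʳ lookup xs (fromℕ< k<)
  take-suc-lookup xs k k< =
    subst (λ m → take (suc m) xs ≡ take m xs ∷ʳ lookup xs (fromℕ< k<)) (toℕ-fromℕ< k<) (take-suc xs (fromℕ< k<))

module _ {σ : ℕ} where

  Str : Set
  Str = List (Fin σ)

  Labels : Set
  Labels = List Str

  Rep : Labels → Str → Set
  Rep Ls w = w ∈ [] ∷ Ls

  Represented⇒Rep : ∀ {H : Heap σ} {w} → Represented H w → Rep (map proj₁ H) w
  Represented⇒Rep (inj₁ refl) = here refl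
  Represented⇒Rep (inj₂ m)    = there m

  Rep⇒Represented : ∀ {H : Heap σ} {w} → Rep (map proj₁ H) w → Represented H w
  Rep⇒Represented (here refl) = inj₁ refl
  Rep⇒Represented (there m)   = inj₂ m

  represented?-true : ∀ (H : Heap σ) {w} → Rep (map proj₁ H) w → represented? H w ≡ true
  represented?-true H {[]}    _         = refl
  represented?-true H {x ∷ w} (here ())
  represented?-true H {x ∷ w} (there m) = isYes-true (∈?-with labelDec (x ∷ w) (map proj₁ H)) m

  represented?-false : ∀ (H : Heap σ) {w} → ¬ Rep (map proj₁ H) w → represented? H w ≡ false
  represented?-false H {[]}    ¬r = contradiction (here refl) ¬r
  represented?-false H {x ∷ w} ¬r = isYes-false (∈?-with labelDec (x ∷ w) (map proj₁ H)) (λ m → ¬r (there m))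

  PrefixClosed : Labels → Set
  PrefixClosed Ls = ∀ {w b} → Rep Ls (w ∷ʳ b) → Rep Ls w

  SuffixClosed : Labels → Set
  SuffixClosed Ls = ∀ {x w} → Rep Ls (x ∷ w) → Rep Ls w

  Rep-prefix : ∀ {Ls} → PrefixClosed Ls → ∀ ys {w} → Rep Ls (w ++ ys) → Rep Ls w
  Rep-prefix pc []       {w} r = subst (Rep _) (++-identityʳ w) r
  Rep-prefix pc (y ∷ ys) {w} r = pc (Rep-prefix pc ys (subst (Rep _) (sym (++-assoc w [ y ] ys)) r))

  heapFrom : ℕ → Labels → Heap σ
  heapFrom k []       = []
  heapFrom k (w ∷ Ls) = (w , k ∷ []) ∷ heapFrom (suc k) Ls

  heap : Labels → Heap σ
  heap = heapFrom 1

  heapFrom-∷ʳ : ∀ k Ls W → heapFrom k (Ls ∷ʳ W) ≡ heapFrom k Ls ∷ʳ (W , k + length Ls ∷ [])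
  heapFrom-∷ʳ k []       W = cong (λ m → (W , m ∷ []) ∷ []) (sym (+-identityʳ k))
  heapFrom-∷ʳ k (w ∷ Ls) W = cong ((w , k ∷ []) ∷_)
    (trans (heapFrom-∷ʳ (suc k) Ls W) (cong (λ m → heapFrom (suc k) Ls ∷ʳ (W , m ∷ [])) (sym (+-suc k (length Ls)))))

  data Primaries : ℕ → Labels → Heap σ → Set where
    []  : ∀ {k} → Primaries k [] []
    _∷_ : ∀ {k w ps Ls H} → All (k ≤_) ps → Primaries (suc k) Ls H → Primaries k (w ∷ Ls) ((w , k ∷ ps) ∷ H)

  heapFrom-primaries : ∀ k Ls → Primaries k Ls (heapFrom k Ls)
  heapFrom-primaries k []       = []
  heapFrom-primaries k (w ∷ Ls) = [] ∷ heapFrom-primaries (suc k) Ls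

  Primaries-labels : ∀ {k Ls H} → Primaries k Ls H → map proj₁ H ≡ Ls
  Primaries-labels []                 = refl
  Primaries-labels (_∷_ {w = w} _ P) = cong (w ∷_) (Primaries-labels P)

  heapFrom-labels : ∀ k Ls → map proj₁ (heapFrom k Ls) ≡ Ls
  heapFrom-labels k Ls = Primaries-labels (heapFrom-primaries k Ls)

  addPos-primaries : ∀ u q {k Ls H} → Primaries k Ls H → k + length Ls ≤ q → Primaries k Ls (addPos u q H)
  addPos-primaries u q []                                 _ = []
  addPos-primaries u q {k} (_∷_ {w = w} {Ls = Ls} ps≥ P) q≥ with labelDec u w
  ... | yes _ = ∷ʳ⁺ ps≥ (≤-trans (m≤m+n k _) q≥) ∷ P
  ... | no _  = ps≥ ∷ addPos-primaries u q P (subst (_≤ q) (+-suc k (length Ls)) q≥)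

  insertSuffix-represented : ∀ (H : Heap σ) u i → represented? H u ≡ true → insertSuffix u i H ≡ addPos u i H
  insertSuffix-represented H u i r with represented? H u
  insertSuffix-represented H u i refl | .true = refl

  insertSuffix-unrepresented : ∀ (H : Heap σ) u i → represented? H u ≡ false →
    insertSuffix u i H ≡ H ∷ʳ (take (suc (lrp H u (length u))) u , i ∷ [])
  insertSuffix-unrepresented H u i r with represented? H u
  insertSuffix-unrepresented H u i refl | .false = refl

  insertFrom-represented : ∀ {k Ls H} → SuffixClosed Ls → ∀ v q → Rep Ls v → Primaries k Ls H →
    k + length Ls ≤ q → Primaries k Ls (insertFrom q v H)
  insertFrom-represented sc []       q _ P _  = P
  insertFrom-represented {H = H} sc (x ∷ xs) q r P q≥ =
    insertFrom-represented sc xs (suc q) (sc r)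
      (subst (Primaries _ _) (sym (insertSuffix-represented H (x ∷ xs) q
         (represented?-true H (subst (λ L → Rep L _) (sym (Primaries-labels P)) r))))
        (addPos-primaries (x ∷ xs) q P q≥))
      (≤-trans q≥ (n≤1+n q))

  foldr-⊓-lower : ∀ k (ps : List ℕ) → All (k ≤_) ps → foldr _⊓_ k ps ≡ k
  foldr-⊓-lower k []       []         = refl
  foldr-⊓-lower k (x ∷ ps) (k≤x ∷ ks) = trans (cong (x ⊓_) (foldr-⊓-lower k ps ks)) (m≥n⇒m⊓n≡n k≤x)

  primary-position : ∀ {k Ls H} → Primaries k Ls H → Distinct Ls → ∀ {j w} → Ls [ j ]= w →
    primary (positionsOf H w) ≡ just (k + j)
  primary-position {k} (_∷_ {w = w} {ps} ps≥ P) d at-zero with labelDec w w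
  ... | yes _ = cong just (trans (foldr-⊓-lower k ps ps≥) (sym (+-identityʳ k)))
  ... | no w≢w = contradiction refl w≢w
  primary-position {k} (_∷_ {w = w′} ps≥ P) d {suc j} {w} (at-suc p) with labelDec w w′
  ... | yes refl = contradiction (d at-zero (at-suc p)) (λ ())
  ... | no _ = trans (primary-position P (Distinct-∷⁻ d) p) (cong just (sym (+-suc k j)))

  lrp-≡ : ∀ (H : Heap σ) u K d → d ≤ K → represented? H (take d u) ≡ true →
    (∀ k → d < k → represented? H (take k u) ≡ false) → lrp H u K ≡ d
  lrp-≡ H u zero    zero d≤ rep beyond = refl
  lrp-≡ H u (suc K) d    d≤ rep beyond with d ℕ.≟ suc K
  ... | yes refl rewrite rep = refl
  ... | no d≢ rewrite beyond (suc K) (≤∧≢⇒< d≤ d≢) = lrp-≡ H u K d (<⇒≤pred (≤∧≢⇒< d≤ d≢)) rep beyond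

  insertSuffix-new : ∀ Ls → PrefixClosed Ls → ∀ {V a} z → Rep Ls V → ¬ Rep Ls (V ∷ʳ a) →
    insertSuffix ((V ∷ʳ a) ++ z) (suc (length Ls)) (heap Ls) ≡ heap (Ls ∷ʳ (V ∷ʳ a))
  insertSuffix-new Ls pc {V} {a} z V∈ W∉ = begin
      insertSuffix u q H
    ≡⟨ insertSuffix-unrepresented H u q (represented?-false H (W∉ ∘ Rep-prefix pc z ∘ fromH)) ⟩
      H ∷ʳ (take (suc (lrp H u (length u))) u , q ∷ [])
    ≡⟨ cong (λ m → H ∷ʳ (take (suc m) u , q ∷ [])) lrp≡ ⟩
      H ∷ʳ (take (suc (length V)) u , q ∷ [])
    ≡⟨ cong (λ t → H ∷ʳ (t , q ∷ [])) take-W ⟩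
      H ∷ʳ (V ∷ʳ a , q ∷ [])
    ≡⟨ sym (heapFrom-∷ʳ 1 Ls (V ∷ʳ a)) ⟩
      heap (Ls ∷ʳ (V ∷ʳ a)) ∎
    where
    open ≡-Reasoning
    u = (V ∷ʳ a) ++ z
    q = suc (length Ls)
    H = heap Ls

    fromH : ∀ {w} → Rep (map proj₁ H) w → Rep Ls w
    fromH = subst (λ L → Rep L _) (heapFrom-labels 1 Ls)

    toH : ∀ {w} → Rep Ls w → Rep (map proj₁ H) w
    toH = subst (λ L → Rep L _) (sym (heapFrom-labels 1 Ls))

    take-u : ∀ n → take (length V + n) u ≡ V ++ take n (a ∷ z)
    take-u n = trans (cong (take _) (++-assoc V [ a ] z)) (take-length-++ V (a ∷ z) n)

    take-V : take (length V) u ≡ V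
    take-V = trans (cong (λ m → take m u) (sym (+-identityʳ (length V)))) (trans (take-u 0) (++-identityʳ V))

    take-W : take (suc (length V)) u ≡ V ∷ʳ a
    take-W = trans (cong (λ m → take m u) (+-comm 1 (length V))) (take-u 1)

    beyond : ∀ k → length V < k → represented? H (take k u) ≡ false
    beyond k V< with m≤n⇒∃[o]m+o≡n V<
    ... | r , refl = represented?-false H λ rep → W∉ (Rep-prefix pc (take r z) (subst (Rep Ls) take-Wr (fromH rep)))
      where
      take-Wr : take (suc (length V) + r) u ≡ (V ∷ʳ a) ++ take r z
      take-Wr = trans (cong (λ m → take m u) (sym (+-suc (length V) r)))
                  (trans (take-u (suc r)) (sym (++-assoc V [ a ] (take r z))))

    lrp≡ : lrp H u (length u) ≡ length V
    lrp≡ = lrp-≡ H u (length u) (length V)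
      (subst (λ x → length V ≤ length x) (sym (++-assoc V [ a ] z)) (length-++-≤ˡ V))
      (represented?-true H (toH (subst (Rep Ls) (sym take-V) V∈)))
      beyond

  -- Node (suc i) of the algorithm carries the label ([] ∷ Ls) [ i ]: the root is 1 and the
  -- j-th created node is 2 + j, listed in Ls in order of creation.
  data Node (Ls : Labels) : ℕ → Str → Set where
    node : ∀ {i w} → ([] ∷ Ls) [ i ]= w → Node Ls (suc i) w

  Node-root : ∀ {Ls} → Node Ls root []
  Node-root = node at-zero

  Node-label : ∀ {Ls u w w′} → Node Ls u w → Node Ls u w′ → w ≡ w′
  Node-label (node p) (node q) = []=-functional p q

  Node-unique : ∀ {Ls u u′ w} → Distinct ([] ∷ Ls) → Node Ls u w → Node Ls u′ w → u ≡ u′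
  Node-unique d (node p) (node q) = cong suc (d p q)

  Node⇒Rep : ∀ {Ls u w} → Node Ls u w → Rep Ls w
  Node⇒Rep (node p) = []=⇒∈ p

  Node-++⁺ : ∀ {Ls u w} ys → Node Ls u w → Node (Ls ++ ys) u w
  Node-++⁺ ys (node p) = node ([]=-++⁺ ys p)

  Node-∷ʳ : ∀ Ls W → Node (Ls ∷ʳ W) (suc (suc (length Ls))) W
  Node-∷ʳ Ls W = node ([]=-∷ʳ ([] ∷ Ls) W)

  Node-∷ʳ⁻ : ∀ Ls {W u w} → Node (Ls ∷ʳ W) u w → Node Ls u w ⊎ (u ≡ suc (suc (length Ls)) × w ≡ W)
  Node-∷ʳ⁻ Ls (node p) with []=-∷ʳ⁻ ([] ∷ Ls) p
  ... | inj₁ q              = inj₁ (node q)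
  ... | inj₂ (refl , refl)  = inj₂ (refl , refl)

  Node-≢bot : ∀ {Ls u w} → Node Ls u w → u ≢ bot
  Node-≢bot (node _) ()

  Node-< : ∀ {Ls u w} → Node Ls u w → u < suc (suc (length Ls))
  Node-< (node p) = s≤s ([]=⇒<length p)

  Rep-∷ʳ⁻ : ∀ Ls {W w} → Rep (Ls ∷ʳ W) w → Rep Ls w ⊎ w ≡ W
  Rep-∷ʳ⁻ Ls r with ∈-++⁻ ([] ∷ Ls) r
  ... | inj₁ r′        = inj₁ r′
  ... | inj₂ (here e)  = inj₂ e

  updEdge-same : ∀ (e : ℕ → Fin σ → Maybe ℕ) u a v → updEdge e u a v u a ≡ just v
  updEdge-same e u a v rewrite isYes-true (u ℕ.≟ u) refl | isYes-true (a Fin.≟ a) refl = refl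

  updEdge-other : ∀ (e : ℕ → Fin σ → Maybe ℕ) u a v x b → x ≢ u → updEdge e u a v x b ≡ e x b
  updEdge-other e u a v x b x≢u rewrite isYes-false (x ℕ.≟ u) x≢u = refl

  updEdge-just⁻ : ∀ (e : ℕ → Fin σ → Maybe ℕ) u a v x b {y} → updEdge e u a v x b ≡ just y →
    (x ≡ u × b ≡ a × y ≡ v) ⊎ e x b ≡ just y
  updEdge-just⁻ e u a v x b eq with x ℕ.≟ u | b Fin.≟ a
  ... | yes refl | yes refl = inj₁ (refl , refl , sym (just-injective eq))
  ... | yes _    | no _     = inj₂ eq
  ... | no _     | _        = inj₂ eq

  updEdge-just : ∀ (e : ℕ → Fin σ → Maybe ℕ) u a v x b {y} → e x b ≡ just y →
    ∃ λ y′ → updEdge e u a v x b ≡ just y′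
  updEdge-just e u a v x b {y} eq with x ℕ.≟ u | b Fin.≟ a
  ... | yes _ | yes _ = v , refl
  ... | yes _ | no _  = y , eq
  ... | no _  | _     = y , eq

  updFun-same : ∀ (g : ℕ → Maybe ℕ) u v → updFun g u v u ≡ just v
  updFun-same g u v rewrite isYes-true (u ℕ.≟ u) refl = refl

  updFun-other : ∀ (g : ℕ → Maybe ℕ) u v x → x ≢ u → updFun g u v x ≡ g x
  updFun-other g u v x x≢u rewrite isYes-false (x ℕ.≟ u) x≢u = refl

  loopBody : State σ → Maybe ℕ → Fin σ → ℕ → State σ
  loopBody s l a c = record s
    { edges = updEdge (edges s) (cur s) a (next s)
    ; suf   = setLast (suf s) l (next s)
    ; pos   = updFun (pos s) (next s) (csuf s)
    ; next  = suc (next s)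
    ; cur   = c
    ; csuf  = suc (csuf s)
    }

  record Trie (s : State σ) (Ls : Labels) (p : ℕ) : Set where
    field
      size          : length Ls ≡ p
      distinct      : Distinct ([] ∷ Ls)
      prefix-closed : PrefixClosed Ls
      bot-edge      : ∀ b → edges s bot b ≡ just root
      edge-sound    : ∀ {u w b v} → Node Ls u w → edges s u b ≡ just v → Node Ls v (w ∷ʳ b)
      edge-complete : ∀ {u w b} → Node Ls u w → Rep Ls (w ∷ʳ b) → ∃ λ v → edges s u b ≡ just v
      fresh-leaf    : ∀ {u} b → suc (suc p) ≤ u → edges s u b ≡ nothing
      created-pos   : ∀ {j} → j < p → pos s (suc (suc j)) ≡ just (suc j)
      next-fresh    : next s ≡ suc (suc p)
      csuf-fresh    : csuf s ≡ suc p

  Trie-init : Trie initState [] 0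
  Trie-init = record
    { size          = refl
    ; distinct      = λ { at-zero at-zero → refl }
    ; prefix-closed = λ { {w} {b} (here e) → contradiction e (∷ʳ≢[] w b) }
    ; bot-edge      = λ b → refl
    ; edge-sound    = λ { (node at-zero) () }
    ; edge-complete = λ { {w = w} {b} _ (here e) → contradiction e (∷ʳ≢[] w b) }
    ; fresh-leaf    = λ {u} b 2≤u → cong (λ d → if d then just root else nothing)
                        (isYes-false (u ℕ.≟ bot) (λ { refl → contradiction 2≤u λ () }))
    ; created-pos   = λ ()
    ; next-fresh    = refl
    ; csuf-fresh    = refl
    }

  Node-next : ∀ {s Ls p} W → Trie s Ls p → Node (Ls ∷ʳ W) (next s) W
  Node-next {Ls = Ls} W T = subst (λ u → Node (Ls ∷ʳ W) u W) (trans (cong (suc ∘ suc) size) (sym next-fresh)) (Node-∷ʳ Ls W)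
    where open Trie T

  Trie-update-suf-cur : ∀ {s Ls p} g c → Trie s Ls p → Trie (record s { suf = g ; cur = c }) Ls p
  Trie-update-suf-cur g c T = record { T′ }
    where module T′ = Trie T

  Trie-grow : ∀ {s Ls p V a} → Trie s Ls p → Node Ls (cur s) V → ¬ Rep Ls (V ∷ʳ a) →
    ∀ l c → Trie (loopBody s l a c) (Ls ∷ʳ (V ∷ʳ a)) (suc p)
  Trie-grow {s} {Ls} {p} {V} {a} T cur-V W∉ l c = record
    { size          = trans (length-∷ʳ Ls W) (cong suc size)
    ; distinct      = distinct′
    ; prefix-closed = prefix-closed′
    ; bot-edge      = λ b → trans (updEdge-other (edges s) (cur s) a (next s) bot b (Node-≢bot cur-V ∘ sym)) (bot-edge b)
    ; edge-sound    = edge-sound′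
    ; edge-complete = edge-complete′
    ; fresh-leaf    = fresh-leaf′
    ; created-pos   = created-pos′
    ; next-fresh    = cong suc next-fresh
    ; csuf-fresh    = cong suc csuf-fresh
    }
    where
    open Trie T
    W = V ∷ʳ a
    Ls′ = Ls ∷ʳ W
    s′ = loopBody s l a c

    distinct′ : Distinct ([] ∷ Ls′)
    distinct′ = Distinct-∷ʳ distinct W∉

    prefix-closed′ : PrefixClosed Ls′
    prefix-closed′ {w} r with Rep-∷ʳ⁻ Ls r
    ... | inj₁ r′ = ∈-++⁺ˡ (prefix-closed r′)
    ... | inj₂ e  = ∈-++⁺ˡ (subst (Rep Ls) (sym (proj₁ (∷ʳ-injective w V e))) (Node⇒Rep cur-V))

    edge-sound′ : ∀ {u w b v} → Node Ls′ u w → edges s′ u b ≡ just v → Node Ls′ v (w ∷ʳ b)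
    edge-sound′ {u} {w} {b} n eq with updEdge-just⁻ (edges s) (cur s) a (next s) u b eq
    ... | inj₁ (refl , refl , refl) =
          subst (λ x → Node Ls′ (next s) (x ∷ʳ a)) (Node-label (Node-++⁺ [ W ] cur-V) n) (Node-next W T)
    ... | inj₂ eq′ with Node-∷ʳ⁻ Ls n
    ...   | inj₁ n′       = Node-++⁺ [ W ] (edge-sound n′ eq′)
    ...   | inj₂ (refl , _) = contradiction (trans (sym eq′) (fresh-leaf b (≤-reflexive (cong (suc ∘ suc) (sym size))))) λ ()

    edge-complete′ : ∀ {u w b} → Node Ls′ u w → Rep Ls′ (w ∷ʳ b) → ∃ λ v → edges s′ u b ≡ just v
    edge-complete′ {u} {w} {b} n r with Rep-∷ʳ⁻ Ls r
    ... | inj₂ e with ∷ʳ-injective w V e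
    ...   | refl , refl with Node-unique distinct′ n (Node-++⁺ [ W ] cur-V)
    ...     | refl = next s , updEdge-same (edges s) (cur s) a (next s)
    edge-complete′ {u} {w} {b} n r | inj₁ r′ with Node-∷ʳ⁻ Ls n
    ... | inj₁ n′ = updEdge-just (edges s) (cur s) a (next s) u b (proj₂ (edge-complete n′ r′))
    ... | inj₂ (_ , refl) = contradiction (prefix-closed r′) W∉

    fresh-leaf′ : ∀ {u} b → suc (suc (suc p)) ≤ u → edges s′ u b ≡ nothing
    fresh-leaf′ {u} b 3+p≤u =
      trans (updEdge-other (edges s) (cur s) a (next s) u b u≢cur) (fresh-leaf b (≤-trans (n≤1+n _) 3+p≤u))
      where
      u≢cur : u ≢ cur s
      u≢cur refl = <-asym (subst (λ m → cur s < suc (suc m)) size (Node-< cur-V)) 3+p≤u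

    created-pos′ : ∀ {j} → j < suc p → pos s′ (suc (suc j)) ≡ just (suc j)
    created-pos′ {j} j<1+p with j ℕ.≟ p
    ... | yes refl = trans (cong (updFun (pos s) (next s) (csuf s)) (sym next-fresh))
                       (trans (updFun-same (pos s) (next s) (csuf s)) (cong just csuf-fresh))
    ... | no j≢p = trans (updFun-other (pos s) (next s) (csuf s) (suc (suc j))
                            (j≢p ∘ suc-injective ∘ suc-injective ∘ flip trans next-fresh))
                     (created-pos (≤∧≢⇒< (≤-pred j<1+p) j≢p))

  -- In the construction of PH of any extension of S, the first p suffixes create the nodes Ls in order.
  Run : Str → Labels → ℕ → Set
  Run S Ls p = ∀ z → insertFrom 1 (S ++ z) [] ≡ insertFrom (suc p) (drop p S ++ z) (heap Ls)

  Run-∷ʳ : ∀ {S Ls p} a → Run S Ls p → p ≤ length S → Run (S ∷ʳ a) Ls p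
  Run-∷ʳ {S} {Ls} {p} a run p≤ z = begin
      insertFrom 1 ((S ∷ʳ a) ++ z) []
    ≡⟨ cong (λ x → insertFrom 1 x []) (++-assoc S [ a ] z) ⟩
      insertFrom 1 (S ++ a ∷ z) []
    ≡⟨ run (a ∷ z) ⟩
      insertFrom (suc p) (drop p S ++ a ∷ z) (heap Ls)
    ≡⟨ cong (λ x → insertFrom (suc p) x (heap Ls)) (sym (++-assoc (drop p S) [ a ] z)) ⟩
      insertFrom (suc p) ((drop p S ∷ʳ a) ++ z) (heap Ls)
    ≡⟨ cong (λ x → insertFrom (suc p) (x ++ z) (heap Ls)) (sym (drop-++ p S [ a ] p≤)) ⟩
      insertFrom (suc p) (drop p (S ∷ʳ a) ++ z) (heap Ls) ∎
    where open ≡-Reasoning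

  Run-step : ∀ {S Ls p V a} → Run S Ls p → length Ls ≡ p → PrefixClosed Ls → Rep Ls V → ¬ Rep Ls (V ∷ʳ a) →
    drop p S ≡ V ∷ʳ a → Run S (Ls ∷ʳ (V ∷ʳ a)) (suc p)
  Run-step {S} {Ls} {V = V} {a} run refl pc V∈ W∉ dropW z
    with drop-suc (length Ls) S (≰⇒> λ le → ∷ʳ≢[] V a (trans (sym dropW) (drop-all _ S le)))
  ... | y , dropy = begin
      insertFrom 1 (S ++ z) []
    ≡⟨ run z ⟩
      insertFrom (suc p) (drop p S ++ z) (heap Ls)
    ≡⟨ cong (λ x → insertFrom (suc p) (x ++ z) (heap Ls)) dropy ⟩
      insertFrom (suc (suc p)) (drop (suc p) S ++ z) (insertSuffix ((y ∷ drop (suc p) S) ++ z) (suc p) (heap Ls))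
    ≡⟨ cong (λ x → insertFrom (suc (suc p)) (drop (suc p) S ++ z) (insertSuffix (x ++ z) (suc p) (heap Ls)))
            (trans (sym dropy) dropW) ⟩
      insertFrom (suc (suc p)) (drop (suc p) S ++ z) (insertSuffix ((V ∷ʳ a) ++ z) (suc p) (heap Ls))
    ≡⟨ cong (insertFrom (suc (suc p)) (drop (suc p) S ++ z)) (insertSuffix-new Ls pc z V∈ W∉) ⟩
      insertFrom (suc (suc p)) (drop (suc p) S ++ z) (heap (Ls ∷ʳ (V ∷ʳ a))) ∎
    where
    open ≡-Reasoning
    p = length Ls

  Run⇒PH : ∀ {S Ls p} → Run S Ls p → PH S ≡ insertFrom (suc p) (drop p S) (heap Ls)
  Run⇒PH {S} {Ls} {p} run =
    trans (cong (λ x → insertFrom 1 x []) (sym (++-identityʳ S)))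
      (trans (run []) (cong (λ x → insertFrom (suc p) x (heap Ls)) (++-identityʳ (drop p S))))

  Linked : (ℕ → Maybe ℕ) → Labels → Maybe ℕ → Set
  Linked g Ls l = ∀ {j x w} → Ls [ j ]= x ∷ w → l ≢ just (suc (suc j)) →
    ∃ λ v → g (suc (suc j)) ≡ just v × Node Ls v w

  data Pending (S : Str) (Ls : Labels) : ℕ → Maybe ℕ → Set where
    none : ∀ {p} → Pending S Ls p nothing
    last : ∀ {q} → Ls [ q ]= drop q S → Pending S Ls (suc q) (just (suc (suc q)))

  -- currentnode is the node of the suffix of S starting after position p, or ⊥ once even the
  -- empty suffix has been inserted.
  data Current (Ls : Labels) (S : Str) (p : ℕ) : ℕ → Set where
    at-node : ∀ {c} → p ≤ length S → Node Ls c (drop p S) → Current Ls S p c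
    at-bot  : p ≡ suc (length S) → Current Ls S p bot

  Current-++⁺ : ∀ {Ls S p c} ys → Current Ls S p c → Current (Ls ++ ys) S p c
  Current-++⁺ ys (at-node p≤ n) = at-node p≤ (Node-++⁺ ys n)
  Current-++⁺ ys (at-bot p≡)    = at-bot p≡

  relink-root : ∀ {S Ls p l g} v → Pending S Ls p l → g root ≡ just bot → setLast g l v root ≡ just bot
  relink-root v none             eq = eq
  relink-root {g = g} v (last {q} _) eq = trans (updFun-other g (suc (suc q)) v root λ ()) eq

  relink : ∀ {S Ls p l g j x w} v₀ → Linked g Ls l → Pending S Ls p l → Ls [ j ]= x ∷ w →
    ∃ λ v → setLast g l v₀ (suc (suc j)) ≡ just v × (Node Ls v w ⊎ (v ≡ v₀ × w ≡ drop p S))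
  relink v₀ links none at = let v , eq , n = links at (λ ()) in v , eq , inj₁ n
  relink {S} {g = g} {j} v₀ links (last {q} at-q) at with j ℕ.≟ q
  ... | yes refl = v₀ , updFun-same g _ v₀ , inj₂ (refl , proj₂ (drop-≡∷ q S (sym ([]=-functional at at-q))))
  ... | no j≢q   = let v , eq , n = links at (j≢q ∘ suc-injective ∘ suc-injective ∘ just-injective ∘ sym) in
                   v , trans (updFun-other g _ v₀ _ (j≢q ∘ suc-injective ∘ suc-injective)) eq , inj₁ n

  record Inv (S : Str) (s : State σ) (Ls : Labels) (p : ℕ) : Set where
    field
      trie      : Trie s Ls p
      run       : Run S Ls p
      root-link : suf s root ≡ just bot
      links     : Linked (suf s) Ls nothing
      p≤        : p ≤ length S
      current   : Node Ls (cur s) (drop p S)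

  record LoopInv (S : Str) (a : Fin σ) (s : State σ) (l : Maybe ℕ) (Ls : Labels) (p : ℕ) : Set where
    field
      trie      : Trie s Ls p
      run       : Run (S ∷ʳ a) Ls p
      root-link : suf s root ≡ just bot
      links     : Linked (suf s) Ls l
      pending   : Pending (S ∷ʳ a) Ls p l
      current   : Current Ls S p (cur s)

  Inv-init : Inv [] initState [] 0
  Inv-init = record
    { trie = Trie-init ; run = λ z → refl ; root-link = refl ; links = λ () ; p≤ = z≤n ; current = Node-root }

  enter : ∀ {S s Ls p} a → Inv S s Ls p → LoopInv S a s nothing Ls p
  enter a I = record
    { trie = trie ; run = Run-∷ʳ a run p≤ ; root-link = root-link ; links = links
    ; pending = none ; current = at-node p≤ current }
    where open Inv I

  exit : ∀ {S a s l Ls p v} → LoopInv S a s l Ls p → edges s (cur s) a ≡ just v →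
    Inv (S ∷ʳ a) (record s { cur = v ; suf = setLast (suf s) l v }) Ls p
  exit {S} {a} {s} {l} {Ls} {p} {v} L eq = record
    { trie      = Trie-update-suf-cur _ v trie
    ; run       = run
    ; root-link = relink-root v pending root-link
    ; links     = links′
    ; p≤        = proj₁ target
    ; current   = proj₂ target
    }
    where
    open LoopInv L
    open Trie trie
    S′ = S ∷ʳ a

    target-from : ∀ {c} → Current Ls S p c → edges s c a ≡ just v → p ≤ length S′ × Node Ls v (drop p S′)
    target-from (at-node p≤ n) e =
      subst (p ≤_) (sym (length-∷ʳ S a)) (≤-trans p≤ (n≤1+n _)) ,
      subst (Node Ls v) (sym (drop-++ p S [ a ] p≤)) (edge-sound n e)
    target-from (at-bot p≡) e with trans (sym e) (bot-edge a)
    ... | refl = ≤-reflexive p≡′ , subst (Node Ls root) (sym (drop-all p S′ (≤-reflexive (sym p≡′)))) Node-root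
      where
      p≡′ : p ≡ length S′
      p≡′ = trans p≡ (sym (length-∷ʳ S a))

    target : p ≤ length S′ × Node Ls v (drop p S′)
    target = target-from current eq

    links′ : Linked (setLast (suf s) l v) Ls nothing
    links′ at _ with relink v links pending at
    ... | v′ , e , inj₁ n         = v′ , e , n
    ... | v′ , e , inj₂ (refl , w≡) = v , e , subst (Node Ls v) (sym w≡) (proj₂ target)

  module LoopBody {S a s l Ls p} (L : LoopInv S a s l Ls p) (no-edge : edges s (cur s) a ≡ nothing) where
    open LoopInv L
    open Trie trie

    S′ = S ∷ʳ a
    V  = drop p S
    W  = V ∷ʳ a
    Ls′ = Ls ∷ʳ W

    at-node-of : ∀ {c} → Current Ls S p c → edges s c a ≡ nothing → p ≤ length S × Node Ls c V
    at-node-of (at-node p≤ n) _ = p≤ , n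
    at-node-of (at-bot _)     e = contradiction (trans (sym e) (bot-edge a)) λ ()

    p≤ : p ≤ length S
    p≤ = proj₁ (at-node-of current no-edge)

    cur-V : Node Ls (cur s) V
    cur-V = proj₂ (at-node-of current no-edge)

    W∉ : ¬ Rep Ls W
    W∉ r = contradiction (trans (sym no-edge) (proj₂ (edge-complete cur-V r))) λ ()

    dropW : drop p S′ ≡ W
    dropW = drop-++ p S [ a ] p≤

    -- currentnode is not the pending node, as the tail of its label V would then be V ∷ʳ a.
    advance-from : ∀ {u w} → V ≡ w → Node Ls u w →
      ∃ λ c → setLast (suf s) l (next s) u ≡ just c × Current Ls S (suc p) c
    advance-from {w = []} V≡ n with Node-unique distinct n Node-root
    ... | refl = bot , relink-root (next s) pending root-link , at-bot (cong suc (≤-antisym p≤ (drop-≡[] p S V≡)))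
    advance-from {w = x ∷ w} V≡ (node (at-suc at)) with drop-≡∷ p S V≡ | relink (next s) links pending at
    ... | p< , w≡ | v , eq , inj₁ n            = v , eq , at-node p< (subst (Node Ls v) w≡ n)
    ... | _       | v , eq , inj₂ (_ , w≡W)    =
      contradiction (trans w≡W (trans dropW (cong (_∷ʳ a) V≡))) (≢∷∷ʳ w x a)

    advance : ∃ λ c → setLast (suf s) l (next s) (cur s) ≡ just c × Current Ls S (suc p) c
    advance = advance-from refl cur-V

    links′ : Linked (setLast (suf s) l (next s)) Ls′ (just (next s))
    links′ at ne with []=-∷ʳ⁻ Ls at
    ... | inj₂ (refl , _) = contradiction (cong just (trans next-fresh (cong (suc ∘ suc) (sym size)))) ne
    ... | inj₁ at′ with relink (next s) links pending at′
    ...   | v , eq , inj₁ n            = v , eq , Node-++⁺ [ W ] n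
    ...   | v , eq , inj₂ (refl , w≡)  = next s , eq , subst (Node Ls′ (next s)) (sym (trans w≡ dropW)) (Node-next W trie)

    preserved : ∀ c → setLast (suf s) l (next s) (cur s) ≡ just c →
      LoopInv S a (loopBody s l a c) (just (next s)) Ls′ (suc p)
    preserved c ceq = record
      { trie      = Trie-grow trie cur-V W∉ l c
      ; run       = Run-step run size prefix-closed (Node⇒Rep cur-V) W∉ dropW
      ; root-link = relink-root (next s) pending root-link
      ; links     = links′
      ; pending   = subst (λ m → Pending S′ Ls′ (suc p) (just m)) (sym next-fresh)
                      (last (subst₂ (Ls′ [_]=_) size (sym dropW) ([]=-∷ʳ Ls W)))
      ; current   = subst (Current Ls′ S (suc p)) (just-injective (trans (sym (proj₁ (proj₂ advance))) ceq))
                      (Current-++⁺ [ W ] (proj₂ (proj₂ advance)))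
      }

  while-cost : ∀ {S a s l Ls p s′ l′ t} → LoopInv S a s l Ls p → While a s l s′ l′ t →
    ∃ λ Ls′ → ∃ λ p′ → LoopInv S a s′ l′ Ls′ p′ × t + 2 * p ≡ suc (2 * p′)
  while-cost {Ls = Ls} {p} L (stop _) = Ls , p , L , refl
  while-cost {p = p} L (loop {t = t} {c} no-edge ceq w) with while-cost (LoopBody.preserved L no-edge c ceq) w
  ... | Ls′ , p′ , L′ , cost = Ls′ , p′ , L′ , trans (sym (two-per-node t p)) cost
    where
    two-per-node : ∀ t p → t + 2 * suc p ≡ suc (suc t) + 2 * p
    two-per-node t p = trans (cong (t +_) (*-suc 2 p)) (trans (+-suc t _) (cong suc (+-suc t _)))

  -- n bounds the number of nodes still to be created, one for each remaining suffix of S ∷ʳ a.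
  while-terminates : ∀ {S a s l Ls p} n → n + p ≡ suc (length S) → LoopInv S a s l Ls p →
    Σ (State σ) λ s′ → Σ (Maybe ℕ) λ l′ → Σ ℕ λ t →
      While a s l s′ l′ t × ∃ λ v → edges s′ (cur s′) a ≡ just v
  while-terminates {S} {a} {s} {l} {p = p} n n+p≡ L with edges s (cur s) a in e
  ... | just v = s , l , 1 , stop e , v , e
  ... | nothing with n
  ...   | zero = contradiction (subst (_≤ length S) n+p≡ (LoopBody.p≤ L e)) 1+n≰n
  ...   | suc n′ with LoopBody.advance L e
  ...     | c , ceq , _ with while-terminates n′ (trans (+-suc n′ p) n+p≡) (LoopBody.preserved L e c ceq)
  ...       | s″ , l″ , t , w , found = s″ , l″ , suc (suc t) , loop e ceq w , found

  iter-cost : ∀ {S a s s′ t Ls p} → Inv S s Ls p → Iter a s s′ t →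
    ∃ λ Ls′ → ∃ λ p′ → Inv (S ∷ʳ a) s′ Ls′ p′ × t + 2 * p ≡ 3 + 2 * p′
  iter-cost I (iter w e) with while-cost (enter _ I) w
  ... | Ls′ , p′ , L′ , cost = Ls′ , p′ , exit L′ e , cong (suc ∘ suc) cost

  -- The cost is exact: σ + 1 for the initialisation, 3 per letter read and 2 per node created.
  Tracked : Str → State σ → ℕ → Set
  Tracked S s t = ∃ λ Ls → ∃ λ p → Inv S s Ls p × t ≡ 3 * length S + 2 * p + suc σ

  Tracked-∷ʳ : ∀ {S a s s′ t t′} → Tracked S s t → Iter a s s′ t′ → Tracked (S ∷ʳ a) s′ (t + t′)
  Tracked-∷ʳ {S} {a} {t = t} {t′} (Ls , p , I , t≡) it with iter-cost I it
  ... | Ls′ , p′ , I′ , cost = Ls′ , p′ , I′ , (begin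
      t + t′                                  ≡⟨ cong (_+ t′) t≡ ⟩
      3 * n + 2 * p + suc σ + t′              ≡⟨ regroup (3 * n) (2 * p) (suc σ) t′ ⟩
      3 * n + suc σ + (t′ + 2 * p)            ≡⟨ cong (3 * n + suc σ +_) cost ⟩
      3 * n + suc σ + (3 + 2 * p′)            ≡⟨ regroup′ n (suc σ) (2 * p′) ⟩
      3 * suc n + 2 * p′ + suc σ              ≡⟨ cong (λ m → 3 * m + 2 * p′ + suc σ) (sym (length-∷ʳ S a)) ⟩
      3 * length (S ∷ʳ a) + 2 * p′ + suc σ    ∎)
    where
    open ≡-Reasoning
    open import Data.Nat.Tactic.RingSolver
    n = length S
    regroup : ∀ x b c d → x + b + c + d ≡ x + c + (d + b)
    regroup = solve-∀
    regroup′ : ∀ n c y → 3 * n + c + (3 + y) ≡ 3 * suc n + y + c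
    regroup′ = solve-∀

  After⇒Tracked : ∀ {T k s t} → After T k s t → Tracked (take k T) s t
  After⇒Tracked start                = [] , 0 , Inv-init , refl
  After⇒Tracked {T} (step {k} A k< it) =
    subst (λ S → Tracked S _ _) (sym (take-suc-lookup T k k<)) (Tracked-∷ʳ (After⇒Tracked A) it)

  run-exists : ∀ (T : Str) k → k ≤ length T → Σ (State σ) λ s → Σ ℕ λ t → After T k s t
  run-exists T zero    _  = initState , suc σ , start
  run-exists T (suc k) k< with run-exists T k (≤-trans (n≤1+n k) k<)
  ... | s , t , A with After⇒Tracked A
  ... | _ , p , I , _
    with while-terminates (suc (length (take k T)) ∸ p) (m∸n+n≡m (≤-trans (Inv.p≤ I) (n≤1+n _))) (enter _ I)
  ... | _ , _ , _ , w , _ , e = _ , _ , step A k< (iter w e)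

  cost-bound : ∀ n p → p ≤ n → 3 * n + 2 * p + suc σ ≤ (σ + 5) * suc n
  cost-bound n p p≤n = begin
      3 * n + 2 * p + suc σ                      ≤⟨ +-monoˡ-≤ (suc σ) (+-monoʳ-≤ (3 * n) (*-monoʳ-≤ 2 p≤n)) ⟩
      3 * n + 2 * n + suc σ                      ≤⟨ m≤m+n _ (σ * n + 4) ⟩
      3 * n + 2 * n + suc σ + (σ * n + 4)        ≡⟨ expand n σ ⟩
      (σ + 5) * suc n                            ∎
    where
    open ≤-Reasoning
    open import Data.Nat.Tactic.RingSolver
    expand : ∀ n σ → 3 * n + 2 * n + suc σ + (σ * n + 4) ≡ (σ + 5) * suc n
    expand = solve-∀

  module Correctness {S s Ls p} (I : Inv S s Ls p) where
    open Inv I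
    open Trie trie

    reach-Node : ∀ {u w x w₀} → Reach s u w x → Node Ls u w₀ → Node Ls x (w₀ ++ w)
    reach-Node {w₀ = w₀} here n = subst (Node Ls _) (sym (++-identityʳ w₀)) n
    reach-Node {w₀ = w₀} (there {a = b} {w = w} e r) n =
      subst (Node Ls _) (++-assoc w₀ [ b ] w) (reach-Node r (edge-sound n e))

    Node-reach : ∀ {u w₀} w → Node Ls u w₀ → Rep Ls (w₀ ++ w) → ∃ λ x → Reach s u w x
    Node-reach []      n r = _ , here
    Node-reach {w₀ = w₀} (b ∷ w) n r =
      let r′       = subst (Rep Ls) (sym (++-assoc w₀ [ b ] w)) r
          v , e    = edge-complete n (Rep-prefix prefix-closed w r′)
          x , path = Node-reach w (edge-sound n e) r′
      in x , there e path

    Label⇒Node : ∀ {w u} → Label s w u → Node Ls u w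
    Label⇒Node lab = reach-Node lab Node-root

    Rep⇒Label : ∀ {w} → Rep Ls w → ∃ (Label s w)
    Rep⇒Label {w} = Node-reach w Node-root

    Node⇒Label : ∀ {w u} → Node Ls u w → Label s w u
    Node⇒Label {w} n with Rep⇒Label (Node⇒Rep n)
    ... | x , lab = subst (Label s w) (Node-unique distinct (Label⇒Node lab) n) lab

    suffix-closed : SuffixClosed Ls
    suffix-closed (here ())
    suffix-closed (there m) with ∈⇒[]= m
    ... | _ , at = Node⇒Rep (proj₂ (proj₂ (links at λ ())))

    PH-primaries : Primaries 1 Ls (PH S)
    PH-primaries = subst (Primaries 1 Ls) (sym (Run⇒PH {S} {Ls} {p} run))
      (insertFrom-represented suffix-closed (drop p S) (suc p) (Node⇒Rep current) (heapFrom-primaries 1 Ls)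
        (s≤s (≤-reflexive size)))

    Rep⇒PH : ∀ {w} → Rep Ls w → Represented (PH S) w
    Rep⇒PH r = Rep⇒Represented (subst (λ L → Rep L _) (sym (Primaries-labels PH-primaries)) r)

    PH⇒Rep : ∀ {w} → Represented (PH S) w → Rep Ls w
    PH⇒Rep r = subst (λ L → Rep L _) (Primaries-labels PH-primaries) (Represented⇒Rep r)

    correct : Correct S s
    correct = (λ w (u , lab) → Rep⇒PH (Node⇒Rep (Label⇒Node lab)))
            , (λ w r → Rep⇒Label (PH⇒Rep r))
            , (λ w w′ u lab lab′ → Node-label (Label⇒Node lab) (Label⇒Node lab′))
            , primary-correct
            , suffix-correct
      where
      primary-correct : ∀ w u → w ≢ [] → Label s w u → pos s u ≡ primary (positionsOf (PH S) w)
      primary-correct w u w≢[] lab with Label⇒Node lab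
      ... | node at-zero      = contradiction refl w≢[]
      ... | node (at-suc at)  = trans (created-pos (subst (_ <_) size ([]=⇒<length at)))
                                  (sym (primary-position PH-primaries (Distinct-∷⁻ distinct) at))

      suffix-correct : ∀ a w u → Label s (a ∷ w) u → ∃ λ v → suf s u ≡ just v × Label s w v
      suffix-correct a w u lab with Label⇒Node lab
      ... | node (at-suc at) = let v , e , n = links at (λ ()) in v , e , Node⇒Label n

theorem2 : (σ : ℕ) → Σ ℕ λ c → (T : List (Fin σ)) →
    (Σ (State σ) λ s → Σ ℕ λ t → After T (length T) s t × t ≤ c * suc (length T))
    × (∀ k s t → 1 ≤ k → k ≤ length T → After T k s t → Correct (take k T) s)
theorem2 σ = σ + 5 , λ T → linear-run T , λ k s t _ _ A → Correctness.correct (proj₁ (proj₂ (proj₂ (After⇒Tracked A))))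
  where
  linear-run : (T : List (Fin σ)) → Σ (State σ) λ s → Σ ℕ λ t → After T (length T) s t × t ≤ (σ + 5) * suc (length T)
  linear-run T with run-exists T (length T) ≤-refl
  ... | s , t , A with After⇒Tracked A
  ... | _ , p , I , t≡ = s , t , A , subst (λ n → t ≤ (σ + 5) * suc n) whole
                                       (subst (_≤ _) (sym t≡) (cost-bound (length (take (length T) T)) p (Inv.p≤ I)))
    where
    whole : length (take (length T) T) ≡ length T
    whole = cong length (take-all (length T) T ≤-refl)
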